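{- Let $n,m\ge1$ and let $G_{n,m}$ be the complete bipartite graph with sides $A,B$, $|A|=n$, $|B|=m$. Then $d(G_{n,m})=\frac{nm}{n+m}\ge d(\mathcal{P})$ for every partition $\mathcal{P}$ of $A\cup B$ into nonempty parts.
   Context: For a graph $G=(V,E)$, $d(G)=|E|/|V|$. For $S\subseteq V$, $d(S)=|E(S)|/|S|$ where $E(S)$ is the set of edges with both endpoints in $S$. For a partition $\mathcal{P}=\{V_1,\dots,V_k\}$ of $V$ into nonempty parts, $d(\mathcal{P})=\sum_i d(V_i)$. -}

module Defs where

open import Data.Nat using (ℕ; zero; suc; _+_; _*_; _<ᵇ_)
open import Data.Fin using (Fin; toℕ; _≟_)
open import Data.Bool using (Bool; true; false; _∧_; _xor_; if_then_else_)
open import Data.Bool.Properties using (xor-same; xor-comm)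
open import Data.List using (List; []; _∷_; map; allFin)
open import Data.Nat.ListAction using (sum)
open import Data.Integer using (+_)
open import Data.Rational using (ℚ; 0ℚ; _/_) renaming (_+_ to _+ℚ_)
open import Data.Product using (∃)
open import Relation.Nullary using (does)
open import Relation.Binary.PropositionalEquality using (_≡_; refl)

record Graph (N : ℕ) : Set where
  field
    adj    : Fin N → Fin N → Bool
    adj-sym : ∀ u v → adj u v ≡ adj v u
    irrefl : ∀ v → adj v v ≡ false
open Graph public

VSubset : ℕ → Set
VSubset N = Fin N → Bool

indicator : Bool → ℕ
indicator b = if b then 1 else 0

card : ∀ {N} → VSubset N → ℕ
card {N} S = sum (map (λ v → indicator (S v)) (allFin N))

-- |E(S)|: number of edges uv (counted once, via u < v) with u, v ∈ S.
edgesIn : ∀ {N} → Graph N → VSubset N → ℕ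
edgesIn {N} G S =
  sum (map (λ u → sum (map (λ v →
    indicator ((toℕ u <ᵇ toℕ v) ∧ S u ∧ S v ∧ adj G u v)) (allFin N))) (allFin N))

-- a / b as a rational; the value for b = 0 is an irrelevant convention
-- (only ever used with b ≥ 1).
frac : ℕ → ℕ → ℚ
frac a zero    = 0ℚ
frac a (suc b) = (+ a) / suc b

density : ∀ {N} → Graph N → VSubset N → ℚ
density G S = frac (edgesIn G S) (card S)

graphDensity : ∀ {N} → Graph N → ℚ
graphDensity G = density G (λ _ → true)

record Partition (N : ℕ) : Set where
  field
    k     : ℕ
    label : Fin N → Fin k
    nonempty : ∀ (i : Fin k) → ∃ λ v → label v ≡ i
open Partition public

part : ∀ {N} (P : Partition N) → Fin (k P) → VSubset N
part P i v = does (label P v ≟ i)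

sumℚ : List ℚ → ℚ
sumℚ []       = 0ℚ
sumℚ (x ∷ xs) = x +ℚ sumℚ xs

partitionDensity : ∀ {N} → Graph N → Partition N → ℚ
partitionDensity G P = sumℚ (map (λ i → density G (part P i)) (allFin (k P)))

-- Complete bipartite graph G_{n,m} on Fin (n + m): A = {v | v < n},
-- B = {v | v ≥ n}; u ~ v iff exactly one of them lies in A.
completeBipartite : (n m : ℕ) → Graph (n + m)
completeBipartite n m = record
  { adj     = λ u v → (toℕ u <ᵇ n) xor (toℕ v <ᵇ n)
  ; adj-sym = λ u v → xor-comm (toℕ u <ᵇ n) (toℕ v <ᵇ n)
  ; irrefl  = λ v → xor-same (toℕ v <ᵇ n)
  }

-- For S ⊆ A ∪ B with a vertices in A and b in B, every pair of a vertex of S ∩ A and a vertex of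
-- S ∩ B is an edge, so d(S) = ab/(a+b). This function is superadditive:
-- ab/(a+b) + cd/(c+d) ≤ (a+c)(b+d)/(a+b+c+d), which after clearing denominators says (ad - bc)² ≥ 0.
-- Summing over the parts of a partition gives d(P) ≤ nm/(n+m) = d(G).
module Submission where

open import Defs
open import Data.Bool using (true; false; _∧_; _xor_; not; T)
open import Data.Bool.Properties using (∧-zeroʳ)
open import Data.Empty using (⊥-elim)
open import Data.Fin using (Fin; toℕ; _≟_; zero; suc)
open import Data.Integer as ℤ using (+_; +≤+)
import Data.Integer.Properties as ℤ
open import Data.List using (List; []; _∷_; map; allFin; tabulate)
open import Data.List.Properties using (map-tabulate; map-cong)
open import Data.Nat using (ℕ; zero; suc; _+_; _*_; _≤_; _<ᵇ_; NonZero)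
open import Data.Nat.ListAction using (sum)
import Data.Nat.Properties as ℕ
open import Data.Nat.Tactic.RingSolver using (solve-∀)
open import Data.Product using (_×_; _,_)
open import Data.Rational using (ℚ; toℚᵘ) renaming (_+_ to _+ℚ_; _≤_ to _≤ℚ_)
import Data.Rational.Properties as ℚ
open import Data.Rational.Unnormalised using (ℚᵘ; mkℚᵘ; *≤*) renaming (_+_ to _+ᵘ_)
import Data.Rational.Unnormalised.Properties as ℚᵘ
open import Data.Sum using (inj₁; inj₂)
open import Function using (id)
open import Relation.Nullary using (does; ¬_)
open import Relation.Binary.PropositionalEquality

open import Algebra.Properties.Semiring.Sum ℕ.+-*-semiring
  using (sum-syntax; sum-cong-≗; sum-replicate-zero; ∑-distrib-+; ∑-comm; *-distribˡ-sum; *-distribʳ-sum)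

indicator-∧ : ∀ a b → indicator (a ∧ b) ≡ indicator a * indicator b
indicator-∧ false b = refl
indicator-∧ true  b = sym (ℕ.+-identityʳ (indicator b))

indicator-split : ∀ a b → indicator a ≡ indicator (a ∧ b) + indicator (a ∧ not b)
indicator-split false b     = refl
indicator-split true  false = refl
indicator-split true  true  = refl

sum-map-allFin : ∀ {N} (f : Fin N → ℕ) → sum (map f (allFin N)) ≡ ∑[ v < N ] f v
sum-map-allFin f = trans (cong sum (map-tabulate id f)) (sum-tabulate f)
  where
  sum-tabulate : ∀ {N} (f : Fin N → ℕ) → sum (tabulate f) ≡ ∑[ v < N ] f v
  sum-tabulate {zero}  f = refl
  sum-tabulate {suc N} f = cong (_+_ (f zero)) (sum-tabulate (λ v → f (suc v)))

∑-ones : ∀ N → ∑[ v < N ] 1 ≡ N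
∑-ones zero    = refl
∑-ones (suc N) = cong suc (∑-ones N)

∑-indicator-≟ : ∀ {k} (j : Fin k) → ∑[ i < k ] indicator (does (j ≟ i)) ≡ 1
∑-indicator-≟ {suc k} zero    = cong suc (sum-replicate-zero k)
∑-indicator-≟ {suc k} (suc j) = ∑-indicator-≟ j

∑-*-∑ : ∀ {M N} (f : Fin M → ℕ) (g : Fin N → ℕ) →
  ∑[ u < M ] ∑[ v < N ] (f u * g v) ≡ (∑[ u < M ] f u) * (∑[ v < N ] g v)
∑-*-∑ f g = trans (sum-cong-≗ (λ u → sym (*-distribˡ-sum (f u) g))) (sym (*-distribʳ-sum _ f))

_∩_ : ∀ {N} → VSubset N → VSubset N → VSubset N
(S ∩ T) v = S v ∧ T v

∁ : ∀ {N} → VSubset N → VSubset N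
∁ S v = not (S v)

card-∑ : ∀ {N} (S : VSubset N) → card S ≡ ∑[ v < N ] indicator (S v)
card-∑ S = sum-map-allFin (λ v → indicator (S v))

card-∩-∁ : ∀ {N} (S T : VSubset N) → card S ≡ card (S ∩ T) + card (S ∩ ∁ T)
card-∩-∁ {N} S T = begin
  card S
    ≡⟨ card-∑ S ⟩
  ∑[ v < N ] indicator (S v)
    ≡⟨ sum-cong-≗ (λ v → indicator-split (S v) (T v)) ⟩
  ∑[ v < N ] (indicator ((S ∩ T) v) + indicator ((S ∩ ∁ T) v))
    ≡⟨ ∑-distrib-+ (λ v → indicator ((S ∩ T) v)) (λ v → indicator ((S ∩ ∁ T) v)) ⟩
  ∑[ v < N ] indicator ((S ∩ T) v) + ∑[ v < N ] indicator ((S ∩ ∁ T) v)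
    ≡⟨ sym (cong₂ _+_ (card-∑ (S ∩ T)) (card-∑ (S ∩ ∁ T))) ⟩
  card (S ∩ T) + card (S ∩ ∁ T) ∎
  where open ≡-Reasoning

∑-card-part-∩ : ∀ {N} (P : Partition N) (T : VSubset N) → ∑[ i < k P ] card (part P i ∩ T) ≡ card T
∑-card-part-∩ {N} P T = begin
  ∑[ i < k P ] card (part P i ∩ T)
    ≡⟨ sum-cong-≗ (λ i → card-∑ (part P i ∩ T)) ⟩
  ∑[ i < k P ] ∑[ v < N ] indicator (part P i v ∧ T v)
    ≡⟨ ∑-comm (λ i v → indicator (part P i v ∧ T v)) ⟩
  ∑[ v < N ] ∑[ i < k P ] indicator (part P i v ∧ T v)
    ≡⟨ sum-cong-≗ (λ v → sum-cong-≗ (λ i → indicator-∧ (part P i v) (T v))) ⟩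
  ∑[ v < N ] ∑[ i < k P ] (indicator (part P i v) * indicator (T v))
    ≡⟨ sum-cong-≗ (λ v → sym (*-distribʳ-sum (indicator (T v)) (λ i → indicator (part P i v)))) ⟩
  ∑[ v < N ] ((∑[ i < k P ] indicator (part P i v)) * indicator (T v))
    ≡⟨ sum-cong-≗ (λ v → cong (_* indicator (T v)) (∑-indicator-≟ (label P v))) ⟩
  ∑[ v < N ] (1 * indicator (T v))
    ≡⟨ sum-cong-≗ (λ v → ℕ.*-identityˡ (indicator (T v))) ⟩
  ∑[ v < N ] indicator (T v)
    ≡⟨ sym (card-∑ T) ⟩
  card T ∎
  where open ≡-Reasoning

2*m*[m+o]≤m*m+[m+o]*[m+o] : ∀ m o → 2 * (m * (m + o)) ≤ m * m + (m + o) * (m + o)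
2*m*[m+o]≤m*m+[m+o]*[m+o] m o = subst (2 * (m * (m + o)) ≤_) (square-gap m o) (ℕ.m≤m+n _ (o * o))
  where
  square-gap : ∀ m o → 2 * (m * (m + o)) + o * o ≡ m * m + (m + o) * (m + o)
  square-gap = solve-∀

2*m*n≤m*m+n*n : ∀ m n → 2 * (m * n) ≤ m * m + n * n
2*m*n≤m*m+n*n m n with ℕ.≤-total m n
... | inj₁ m≤n with ℕ.m≤n⇒∃[o]m+o≡n m≤n
...   | o , refl = 2*m*[m+o]≤m*m+[m+o]*[m+o] m o
2*m*n≤m*m+n*n m n | inj₂ n≤m with ℕ.m≤n⇒∃[o]m+o≡n n≤m
...   | o , refl = subst₂ _≤_ (cong (2 *_) (ℕ.*-comm n (n + o))) (ℕ.+-comm (n * n) _) (2*m*[m+o]≤m*m+[m+o]*[m+o] n o)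

-- The gap between the two sides is (ad - bc)².
cross-multiplied-≤ : ∀ a b c d →
  (a * b * (c + d) + c * d * (a + b)) * ((a + c) + (b + d)) ≤ (a + c) * (b + d) * ((a + b) * (c + d))
cross-multiplied-≤ a b c d = ℕ.+-cancelʳ-≤ (2 * (a * d * (b * c))) _ _ (begin
  lhs + 2 * (a * d * (b * c))               ≤⟨ ℕ.+-monoʳ-≤ lhs (2*m*n≤m*m+n*n (a * d) (b * c)) ⟩
  lhs + (a * d * (a * d) + b * c * (b * c)) ≡⟨ expand a b c d ⟩
  rhs + 2 * (a * d * (b * c))               ∎)
  where
  open ℕ.≤-Reasoning
  lhs rhs : ℕ
  lhs = (a * b * (c + d) + c * d * (a + b)) * ((a + c) + (b + d))
  rhs = (a + c) * (b + d) * ((a + b) * (c + d))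
  expand : ∀ a b c d →
    (a * b * (c + d) + c * d * (a + b)) * ((a + c) + (b + d)) + (a * d * (a * d) + b * c * (b * c))
      ≡ (a + c) * (b + d) * ((a + b) * (c + d)) + 2 * (a * d * (b * c))
  expand = solve-∀

frac-+-≤ : ∀ x y z s t u .{{_ : NonZero s}} .{{_ : NonZero t}} .{{_ : NonZero u}} →
  (x * t + y * s) * u ≤ z * (s * t) → frac x s +ℚ frac y t ≤ℚ frac z u
frac-+-≤ x y z s@(suc s-1) t@(suc t-1) u@(suc u-1) cross = ℚ.toℚᵘ-cancel-≤ (begin
  toℚᵘ (frac x s +ℚ frac y t)            ≃⟨ ℚ.toℚᵘ-homo-+ (frac x s) (frac y t) ⟩
  toℚᵘ (frac x s) +ᵘ toℚᵘ (frac y t)     ≃⟨ ℚᵘ.+-cong (ℚ.toℚᵘ-fromℚᵘ x/s) (ℚ.toℚᵘ-fromℚᵘ y/t) ⟩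
  x/s +ᵘ y/t                             ≤⟨ *≤* (subst₂ ℤ._≤_ lhs-cast rhs-cast (+≤+ cross)) ⟩
  z/u                                    ≃⟨ ℚ.toℚᵘ-fromℚᵘ z/u ⟨
  toℚᵘ (frac z u)                        ∎)
  where
  open ℚᵘ.≤-Reasoning
  x/s y/t z/u : ℚᵘ
  x/s = mkℚᵘ (+ x) s-1
  y/t = mkℚᵘ (+ y) t-1
  z/u = mkℚᵘ (+ z) u-1
  lhs-cast : + ((x * t + y * s) * u) ≡ (+ x ℤ.* + t ℤ.+ + y ℤ.* + s) ℤ.* + u
  lhs-cast = trans (ℤ.pos-* (x * t + y * s) u) (cong (ℤ._* + u)
    (trans (ℤ.pos-+ (x * t) (y * s)) (cong₂ ℤ._+_ (ℤ.pos-* x t) (ℤ.pos-* y s))))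
  rhs-cast : + (z * (s * t)) ≡ + z ℤ.* + (s * t)
  rhs-cast = ℤ.pos-* z (s * t)

bipartiteDensity : ℕ → ℕ → ℚ
bipartiteDensity a b = frac (a * b) (a + b)

bipartiteDensity-superadditive-nonZero : ∀ a b c d →
  .{{_ : NonZero (a + b)}} .{{_ : NonZero (c + d)}} .{{_ : NonZero ((a + c) + (b + d))}} →
  bipartiteDensity a b +ℚ bipartiteDensity c d ≤ℚ bipartiteDensity (a + c) (b + d)
bipartiteDensity-superadditive-nonZero a b c d =
  frac-+-≤ (a * b) (c * d) ((a + c) * (b + d)) (a + b) (c + d) ((a + c) + (b + d))
    (cross-multiplied-≤ a b c d)

bipartiteDensity-superadditive : ∀ a b c d →
  bipartiteDensity a b +ℚ bipartiteDensity c d ≤ℚ bipartiteDensity (a + c) (b + d)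
bipartiteDensity-superadditive zero zero c d = ℚ.≤-reflexive (ℚ.+-identityˡ (bipartiteDensity c d))
bipartiteDensity-superadditive a b zero zero
  rewrite ℕ.+-identityʳ a | ℕ.+-identityʳ b = ℚ.≤-reflexive (ℚ.+-identityʳ (bipartiteDensity a b))
bipartiteDensity-superadditive a@(suc _) b c@(suc _) d         = bipartiteDensity-superadditive-nonZero a b c d
bipartiteDensity-superadditive a@(suc _) b zero      d@(suc _) = bipartiteDensity-superadditive-nonZero a b zero d
bipartiteDensity-superadditive zero b@(suc _) c@(suc _) d      = bipartiteDensity-superadditive-nonZero zero b c d
bipartiteDensity-superadditive zero b@(suc _) zero d@(suc _)   = bipartiteDensity-superadditive-nonZero zero b zero d

sumℚ-bipartiteDensity-≤ : ∀ {I : Set} (a b : I → ℕ) (is : List I) →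
  sumℚ (map (λ i → bipartiteDensity (a i) (b i)) is) ≤ℚ bipartiteDensity (sum (map a is)) (sum (map b is))
sumℚ-bipartiteDensity-≤ a b []       = ℚ.≤-refl
sumℚ-bipartiteDensity-≤ a b (i ∷ is) = ℚ.≤-trans
  (ℚ.+-monoʳ-≤ (bipartiteDensity (a i) (b i)) (sumℚ-bipartiteDensity-≤ a b is))
  (bipartiteDensity-superadditive (a i) (b i) (sum (map a is)) (sum (map b is)))

sideA : ∀ n m → VSubset (n + m)
sideA n m v = toℕ v <ᵇ n

card-sideA : ∀ n m → card (sideA n m) ≡ n
card-sideA n m = trans (card-∑ (sideA n m)) (count n)
  where
  count : ∀ n → ∑[ v < n + m ] indicator (toℕ v <ᵇ n) ≡ n
  count zero    = sum-replicate-zero m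
  count (suc n) = cong suc (count n)

card-sideB : ∀ n m → card (∁ (sideA n m)) ≡ m
card-sideB n m = trans (card-∑ (∁ (sideA n m))) (count n)
  where
  count : ∀ n → ∑[ v < n + m ] indicator (not (toℕ v <ᵇ n)) ≡ m
  count zero    = ∑-ones m
  count (suc n) = count n

∧-xor-≡-∧-not : ∀ p x y → (T x → ¬ T y → T p) → (¬ T x → T y → ¬ T p) → p ∧ (x xor y) ≡ x ∧ not y
∧-xor-≡-∧-not p     true  true  _  _  = ∧-zeroʳ p
∧-xor-≡-∧-not p     false false _  _  = ∧-zeroʳ p
∧-xor-≡-∧-not true  true  false _  _  = refl
∧-xor-≡-∧-not false true  false xy _  = ⊥-elim (xy _ id)
∧-xor-≡-∧-not true  false true  _  yx = ⊥-elim (yx id _ _)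
∧-xor-≡-∧-not false false true  _  _  = refl

edge-∧ : ∀ p s t x y → p ∧ (x xor y) ≡ x ∧ not y → p ∧ s ∧ t ∧ (x xor y) ≡ (s ∧ x) ∧ (t ∧ not y)
edge-∧ p false t     x y _ = ∧-zeroʳ p
edge-∧ p true  false x y _ = trans (∧-zeroʳ p) (sym (∧-zeroʳ x))
edge-∧ p true  true  x y e = e

module _ (n m : ℕ) where

  private
    A B : VSubset (n + m)
    A = sideA n m
    B = ∁ (sideA n m)

  A-before-B : ∀ u v → T (A u) → ¬ T (A v) → T (toℕ u <ᵇ toℕ v)
  A-before-B u v u∈A v∉A = ℕ.<⇒<ᵇ (ℕ.<-≤-trans (ℕ.<ᵇ⇒< _ n u∈A) (ℕ.≮⇒≥ (λ v<n → v∉A (ℕ.<⇒<ᵇ v<n))))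

  B-not-before-A : ∀ u v → ¬ T (A u) → T (A v) → ¬ T (toℕ u <ᵇ toℕ v)
  B-not-before-A u v u∉A v∈A u<v = u∉A (ℕ.<⇒<ᵇ (ℕ.<-trans (ℕ.<ᵇ⇒< _ _ u<v) (ℕ.<ᵇ⇒< _ n v∈A)))

  edge-indicator : ∀ (S : VSubset (n + m)) u v →
    indicator ((toℕ u <ᵇ toℕ v) ∧ S u ∧ S v ∧ adj (completeBipartite n m) u v)
      ≡ indicator ((S ∩ A) u) * indicator ((S ∩ B) v)
  edge-indicator S u v = trans
    (cong indicator (edge-∧ _ (S u) (S v) (A u) (A v)
      (∧-xor-≡-∧-not _ (A u) (A v) (A-before-B u v) (B-not-before-A u v))))
    (indicator-∧ ((S ∩ A) u) ((S ∩ B) v))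

  edgesIn-completeBipartite : ∀ S → edgesIn (completeBipartite n m) S ≡ card (S ∩ A) * card (S ∩ B)
  edgesIn-completeBipartite S = begin
    edgesIn (completeBipartite n m) S
      ≡⟨ trans (sum-map-allFin (λ u → sum (map (edge u) (allFin (n + m)))))
               (sum-cong-≗ (λ u → sum-map-allFin (edge u))) ⟩
    ∑[ u < n + m ] ∑[ v < n + m ] edge u v
      ≡⟨ sum-cong-≗ (λ u → sum-cong-≗ (edge-indicator S u)) ⟩
    ∑[ u < n + m ] ∑[ v < n + m ] (indicator ((S ∩ A) u) * indicator ((S ∩ B) v))
      ≡⟨ ∑-*-∑ (λ u → indicator ((S ∩ A) u)) (λ v → indicator ((S ∩ B) v)) ⟩
    (∑[ u < n + m ] indicator ((S ∩ A) u)) * (∑[ v < n + m ] indicator ((S ∩ B) v))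
      ≡⟨ sym (cong₂ _*_ (card-∑ (S ∩ A)) (card-∑ (S ∩ B))) ⟩
    card (S ∩ A) * card (S ∩ B) ∎
    where
    open ≡-Reasoning
    edge : Fin (n + m) → Fin (n + m) → ℕ
    edge u v = indicator ((toℕ u <ᵇ toℕ v) ∧ S u ∧ S v ∧ adj (completeBipartite n m) u v)

  density-completeBipartite : ∀ S →
    density (completeBipartite n m) S ≡ bipartiteDensity (card (S ∩ A)) (card (S ∩ B))
  density-completeBipartite S = cong₂ frac (edgesIn-completeBipartite S) (card-∩-∁ S A)

  graphDensity-completeBipartite : graphDensity (completeBipartite n m) ≡ bipartiteDensity n m
  graphDensity-completeBipartite =
    trans (density-completeBipartite (λ _ → true)) (cong₂ bipartiteDensity (card-sideA n m) (card-sideB n m))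

  partitionDensity-completeBipartite-≤ : (P : Partition (n + m)) →
    partitionDensity (completeBipartite n m) P ≤ℚ bipartiteDensity n m
  partitionDensity-completeBipartite-≤ P = begin
    partitionDensity (completeBipartite n m) P
      ≡⟨ cong sumℚ (map-cong (λ i → density-completeBipartite (part P i)) (allFin (k P))) ⟩
    sumℚ (map (λ i → bipartiteDensity (inPart A i) (inPart B i)) (allFin (k P)))
      ≤⟨ sumℚ-bipartiteDensity-≤ (inPart A) (inPart B) (allFin (k P)) ⟩
    bipartiteDensity (sum (map (inPart A) (allFin (k P)))) (sum (map (inPart B) (allFin (k P))))
      ≡⟨ cong₂ bipartiteDensity (total A (card-sideA n m)) (total B (card-sideB n m)) ⟩
    bipartiteDensity n m ∎
    where
    open ℚ.≤-Reasoning
    inPart : VSubset (n + m) → Fin (k P) → ℕ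
    inPart T i = card (part P i ∩ T)
    total : ∀ {c} T → card T ≡ c → sum (map (inPart T) (allFin (k P))) ≡ c
    total T |T|≡c = trans (sum-map-allFin (inPart T)) (trans (∑-card-part-∩ P T) |T|≡c)

lemma4 : (n m : ℕ) → 1 ≤ n → 1 ≤ m →
    (graphDensity (completeBipartite n m) ≡ frac (n * m) (n + m))
    × ((P : Partition (n + m)) →
    partitionDensity (completeBipartite n m) P ≤ℚ graphDensity (completeBipartite n m))
lemma4 n m _ _ =
  graphDensity-completeBipartite n m ,
  λ P → subst (partitionDensity (completeBipartite n m) P ≤ℚ_) (sym (graphDensity-completeBipartite n m))
          (partitionDensity-completeBipartite-≤ n m P)
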